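{- Let $\{g_1,\ldots,g_h\}$ be a generating set for $\Gamma_1(N)$. For $i=1,\ldots,h$, let $\gamma_i\in\langle T,W\rangle g_i\langle T,W\rangle$ be a matrix with top row $\left(\begin{smallmatrix} r_i&b_i\end{smallmatrix}\right)$, and choose $m_i\in\mathbb{Z}$ with $m_i\mid\frac{r_i-1}{N}$. Then, for any $q\in\mathbb{N}$ satisfying $(q,Nm_i)=1$ and $q\equiv Nm_ib_i\pmod{r_i}$ for every $i$, we have $H_q\supseteq\Gamma_1(N)$.
   Context: $T=\left(\begin{smallmatrix} 1&1\\0&1\end{smallmatrix}\right)$, $W=\left(\begin{smallmatrix} 1&0\\ N&1\end{smallmatrix}\right)$. For $q\in\mathbb{N}$ coprime to $N$, $H_q$ is the subgroup of $\Gamma_0(N)$ generated by the matrices $\left\{\begin{pmatrix}A&B\\ C&D\end{pmatrix}\in\Gamma_0(N):A=q\right\}$. -}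

module Defs where

open import Data.Nat using (ℕ)
open import Data.Integer using (ℤ; +_; _+_; _*_; -_; _-_; 0ℤ; 1ℤ)
open import Data.Integer.Divisibility using (_∣_)
open import Data.Product using (Σ; _×_; ∃; _,_)
open import Relation.Binary.PropositionalEquality using (_≡_)

record Mat : Set where
  constructor mat
  field
    A B C D : ℤ
open Mat public

_⊗_ : Mat → Mat → Mat
mat a b c d ⊗ mat a' b' c' d' =
  mat (a * a' + b * c') (a * b' + b * d') (c * a' + d * c') (c * b' + d * d')

det : Mat → ℤ
det (mat a b c d) = a * d - b * c

I : Mat
I = mat 1ℤ 0ℤ 0ℤ 1ℤ

-- inverse in SL₂(ℤ) (the adjugate; equals the inverse when det = 1)
inv : Mat → Mat
inv (mat a b c d) = mat d (- b) (- c) a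

_≡ᶻ_[mod_] : ℤ → ℤ → ℤ → Set
x ≡ᶻ y [mod n ] = n ∣ (x - y)

Γ₀ : ℕ → Mat → Set
Γ₀ N g = (det g ≡ 1ℤ) × ((+ N) ∣ C g)

Γ₁ : ℕ → Mat → Set
Γ₁ N g = (det g ≡ 1ℤ) × (C g ≡ᶻ 0ℤ [mod + N ]) × (A g ≡ᶻ 1ℤ [mod + N ]) × (D g ≡ᶻ 1ℤ [mod + N ])

data ⟨_⟩ (S : Mat → Set) : Mat → Set where
  gen-id  : ⟨ S ⟩ I
  gen-el  : ∀ {g} → S g → ⟨ S ⟩ g
  gen-mul : ∀ {g h} → ⟨ S ⟩ g → ⟨ S ⟩ h → ⟨ S ⟩ (g ⊗ h)
  gen-inv : ∀ {g} → ⟨ S ⟩ g → ⟨ S ⟩ (inv g)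

T : Mat
T = mat 1ℤ 1ℤ 0ℤ 1ℤ

W : ℕ → Mat
W N = mat 1ℤ 0ℤ (+ N) 1ℤ

TW : ℕ → Mat → Set
TW N g = (g ≡ T) Data.Sum.⊎ (g ≡ W N)
  where import Data.Sum

DoubleCoset : ℕ → Mat → Mat → Set
DoubleCoset N g γ = Σ Mat λ x → Σ Mat λ y →
  ⟨ TW N ⟩ x × ⟨ TW N ⟩ y × (γ ≡ (x ⊗ g) ⊗ y)

Hgen : ℕ → ℕ → Mat → Set
Hgen N q g = Γ₀ N g × (A g ≡ + q)

H : ℕ → ℕ → Mat → Set
H N q = ⟨ Hgen N q ⟩

-- m ∣ (r - 1)/N, literally: (r - 1) = N * k with m ∣ k
DividesQuot : ℤ → ℤ → ℕ → Set
DividesQuot m r N = Σ ℤ λ k → (r - 1ℤ ≡ + N * k) × (m ∣ k)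

module Submission where

-- Write H = H_q.  Everything happens inside SL₂(ℤ), where the
-- subgroup ⟨S⟩ generated by S is the least set containing S that is closed
-- under I, ⊗ and inv, and where a subgroup admits cancellation.
--   (1) Since gcd(q, N) = 1, Bézout completes the column (q, N) to a matrix
--       M₀ ∈ Γ₀(N) with upper-left entry q, so M₀ ∈ H.  As M₀·U(k) and W·M₀
--       again have upper-left entry q, cancelling M₀ gives U(k) ∈ H for all k
--       (U(k) the upper unipotent matrix) and W ∈ H; hence ⟨T, W⟩ ⊆ H.
--   (2) For γ ∈ Γ₀(N) with top row (r, b), the hypotheses m ∣ (r - 1)/N and
--       q ≡ N m b (mod r) give r = 1 + N s m and q = N m b + t r; then
--       complete (q, N m) to Y ∈ H and put X = U(-(b + s t))·Y ∈ H.  A direct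
--       computation shows that γ·X has upper-left entry q, so γ·X ∈ H and,
--       cancelling X, γ ∈ H.
--   (3) Each γᵢ = x gᵢ y (x, y ∈ ⟨T, W⟩ ⊆ H) lies in Γ₀(N), hence in H by
--       (2), so gᵢ ∈ H by cancellation; as the gᵢ generate Γ₁(N), Γ₁(N) ⊆ H.

open import Defs
open import Data.Nat using (ℕ; NonZero; suc)
import Data.Nat as ℕ
import Data.Nat.Divisibility as ℕ
open import Data.Nat.Coprimality using (Coprime; coprime-Bézout)
open import Data.Nat.GCD using (module Bézout)
open import Data.Integer using (ℤ; +_; -[1+_]; _+_; _-_; _*_; -_; ∣_∣; 0ℤ; 1ℤ)
open import Data.Integer.Properties
  using (pos-+; pos-*; *-identityˡ; *-zeroʳ; +-identityʳ)
open import Data.Integer.Divisibility using (_∣_)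
import Data.Integer.Divisibility.Signed as Signed
open import Data.Integer.Tactic.RingSolver using (solve-∀)
open import Data.Fin using (Fin)
open import Data.Product using (Σ; _,_; proj₁; proj₂)
open import Data.Sum using (inj₁; inj₂)
open import Relation.Binary.PropositionalEquality
open ≡-Reasoning

mat-cong : ∀ {a a' b b' c c' d d'} → a ≡ a' → b ≡ b' → c ≡ c' → d ≡ d' →
           mat a b c d ≡ mat a' b' c' d'
mat-cong refl refl refl refl = refl

_·_ : ℤ → Mat → Mat
k · mat x y z w = mat (k * x) (k * y) (k * z) (k * w)

1·-identity : ∀ X → 1ℤ · X ≡ X
1·-identity (mat x y z w) =
  mat-cong (*-identityˡ x) (*-identityˡ y) (*-identityˡ z) (*-identityˡ w)

det-⊗ : ∀ M X → det (M ⊗ X) ≡ det M * det X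
det-⊗ (mat a b c d) (mat x y z w) = identity a b c d x y z w
  where
  identity : ∀ a b c d x y z w →
    (a * x + b * z) * (c * y + d * w) - (a * y + b * w) * (c * x + d * z)
      ≡ (a * d - b * c) * (x * w - y * z)
  identity = solve-∀

det-inv : ∀ M → det (inv M) ≡ det M
det-inv (mat a b c d) = identity a b c d
  where
  identity : ∀ a b c d → d * a - (- b) * (- c) ≡ a * d - b * c
  identity = solve-∀

adjugate-⊗ˡ : ∀ M X → inv M ⊗ (M ⊗ X) ≡ det M · X
adjugate-⊗ˡ (mat a b c d) (mat x y z w) =
  mat-cong (top a b c d x z) (top a b c d y w) (bottom a b c d x z) (bottom a b c d y w)
  where
  top : ∀ a b c d x z →
    d * (a * x + b * z) + (- b) * (c * x + d * z) ≡ (a * d - b * c) * x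
  top = solve-∀
  bottom : ∀ a b c d x z →
    (- c) * (a * x + b * z) + a * (c * x + d * z) ≡ (a * d - b * c) * z
  bottom = solve-∀

adjugate-⊗ʳ : ∀ X M → (X ⊗ M) ⊗ inv M ≡ det M · X
adjugate-⊗ʳ (mat x y z w) (mat a b c d) =
  mat-cong (left a b c d x y) (right a b c d x y) (left a b c d z w) (right a b c d z w)
  where
  left : ∀ a b c d x y →
    (x * a + y * c) * d + (x * b + y * d) * (- c) ≡ (a * d - b * c) * x
  left = solve-∀
  right : ∀ a b c d x y →
    (x * a + y * c) * (- b) + (x * b + y * d) * a ≡ (a * d - b * c) * y
  right = solve-∀

SL₂ : Mat → Set
SL₂ M = det M ≡ 1ℤ

inv-cancelˡ : ∀ {M} X → SL₂ M → inv M ⊗ (M ⊗ X) ≡ X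
inv-cancelˡ {M} X detM≡1 = begin
  inv M ⊗ (M ⊗ X)  ≡⟨ adjugate-⊗ˡ M X ⟩
  det M · X        ≡⟨ cong (_· X) detM≡1 ⟩
  1ℤ · X           ≡⟨ 1·-identity X ⟩
  X                ∎

inv-cancelʳ : ∀ {M} X → SL₂ M → (X ⊗ M) ⊗ inv M ≡ X
inv-cancelʳ {M} X detM≡1 = begin
  (X ⊗ M) ⊗ inv M  ≡⟨ adjugate-⊗ʳ X M ⟩
  det M · X        ≡⟨ cong (_· X) detM≡1 ⟩
  1ℤ · X           ≡⟨ 1·-identity X ⟩
  X                ∎

record IsSubgroup (P : Mat → Set) : Set where
  field
    I∈   : P I
    ⊗∈   : ∀ {g h} → P g → P h → P (g ⊗ h)
    inv∈ : ∀ {g} → P g → P (inv g)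
open IsSubgroup

⟨⟩-subgroup : ∀ {S} → IsSubgroup ⟨ S ⟩
⟨⟩-subgroup = record { I∈ = gen-id ; ⊗∈ = gen-mul ; inv∈ = gen-inv }

⟨⟩-least : ∀ {S P} → IsSubgroup P → (∀ {g} → S g → P g) → ∀ {g} → ⟨ S ⟩ g → P g
⟨⟩-least P-sub S⊆P gen-id          = I∈ P-sub
⟨⟩-least P-sub S⊆P (gen-el s)      = S⊆P s
⟨⟩-least P-sub S⊆P (gen-mul g∈ h∈) = ⊗∈ P-sub (⟨⟩-least P-sub S⊆P g∈) (⟨⟩-least P-sub S⊆P h∈)
⟨⟩-least P-sub S⊆P (gen-inv g∈)    = inv∈ P-sub (⟨⟩-least P-sub S⊆P g∈)

SL₂-subgroup : IsSubgroup SL₂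
SL₂-subgroup = record
  { I∈   = refl
  ; ⊗∈   = λ {g} {h} detg≡1 deth≡1 → trans (det-⊗ g h) (cong₂ _*_ detg≡1 deth≡1)
  ; inv∈ = λ {g} detg≡1 → trans (det-inv g) detg≡1
  }

module _ {S : Mat → Set} (S⊆SL₂ : ∀ {g} → S g → SL₂ g) where

  ⟨⟩-cancelˡ : ∀ {M X} → ⟨ S ⟩ M → ⟨ S ⟩ (M ⊗ X) → ⟨ S ⟩ X
  ⟨⟩-cancelˡ {M} {X} M∈ MX∈ =
    subst ⟨ S ⟩ (inv-cancelˡ {M} X (⟨⟩-least SL₂-subgroup S⊆SL₂ M∈)) (gen-mul (gen-inv M∈) MX∈)

  ⟨⟩-cancelʳ : ∀ {M X} → ⟨ S ⟩ M → ⟨ S ⟩ (X ⊗ M) → ⟨ S ⟩ X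
  ⟨⟩-cancelʳ {M} {X} M∈ XM∈ =
    subst ⟨ S ⟩ (inv-cancelʳ {M} X (⟨⟩-least SL₂-subgroup S⊆SL₂ M∈)) (gen-mul XM∈ (gen-inv M∈))

-- The divisibility
-- in Γ₀ is unsigned and only sees absolute values, so the arguments go
-- through signed divisibility, with the divided integers given explicitly.
∣-linear : ∀ n c c' a d → n ∣ c → n ∣ c' → n ∣ c * a + d * c'
∣-linear n c c' a d n∣c n∣c' =
  Signed.∣⇒∣ᵤ {n} {c * a + d * c'}
    (Signed.∣m∣n⇒∣m+n (Signed.∣m⇒∣m*n a (Signed.∣ᵤ⇒∣ {n} {c} n∣c))
                      (Signed.∣n⇒∣m*n d (Signed.∣ᵤ⇒∣ {n} {c'} n∣c')))

∣-negate : ∀ n c → n ∣ c → n ∣ - c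
∣-negate n c n∣c = Signed.∣⇒∣ᵤ {n} { - c} (Signed.∣m⇒∣-m (Signed.∣ᵤ⇒∣ {n} {c} n∣c))

Γ₀-subgroup : ∀ N → IsSubgroup (Γ₀ N)
Γ₀-subgroup N = record
  { I∈   = refl , N ℕ.∣0
  ; ⊗∈   = λ {g} {h} (detg≡1 , N∣Cg) (deth≡1 , N∣Ch) →
      ⊗∈ SL₂-subgroup {g} {h} detg≡1 deth≡1 , ∣-linear (+ N) (C g) (C h) (A h) (D g) N∣Cg N∣Ch
  ; inv∈ = λ {g} (detg≡1 , N∣Cg) → inv∈ SL₂-subgroup {g} detg≡1 , ∣-negate (+ N) (C g) N∣Cg
  }

-- Closure of Γ₀(N) under ⊗ with the factors given explicitly, since a proof of
-- membership in Γ₀(N) does not determine the matrix by unification.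
Γ₀-⊗ : ∀ {N} g h → Γ₀ N g → Γ₀ N h → Γ₀ N (g ⊗ h)
Γ₀-⊗ {N} g h = ⊗∈ (Γ₀-subgroup N) {g} {h}

Γ₁⊆Γ₀ : ∀ {N g} → Γ₁ N g → Γ₀ N g
Γ₁⊆Γ₀ {N} {g} (detg≡1 , Cg≡0 , _) = detg≡1 , subst (+ N ∣_) (+-identityʳ (C g)) Cg≡0

U : ℤ → Mat
U k = mat 1ℤ k 0ℤ 1ℤ

U∈Γ₀ : ∀ N k → Γ₀ N (U k)
U∈Γ₀ N k = cong (λ v → 1ℤ - v) (*-zeroʳ k) , N ℕ.∣0

W∈Γ₀ : ∀ N → Γ₀ N (W N)
W∈Γ₀ N = refl , ℕ.∣-refl

TW⊆Γ₀ : ∀ {N g} → ⟨ TW N ⟩ g → Γ₀ N g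
TW⊆Γ₀ {N} = ⟨⟩-least (Γ₀-subgroup N) λ { (inj₁ refl) → U∈Γ₀ N 1ℤ ; (inj₂ refl) → W∈Γ₀ N }

double-coset-Γ₀ : ∀ {N g γ} → Γ₀ N g → DoubleCoset N g γ → Γ₀ N γ
double-coset-Γ₀ {g = g} g∈ (x , y , x∈ , y∈ , refl) =
  Γ₀-⊗ (x ⊗ g) y (Γ₀-⊗ x g (TW⊆Γ₀ x∈) g∈) (TW⊆Γ₀ y∈)

identity-in-ℤ : ∀ u v s t → 1 ℕ.+ u ℕ.* v ≡ s ℕ.* t → 1ℤ + + u * + v ≡ + s * + t
identity-in-ℤ u v s t eq = begin
  1ℤ + + u * + v     ≡⟨ cong (λ w → 1ℤ + w) (sym (pos-* u v)) ⟩
  1ℤ + + (u ℕ.* v)   ≡⟨ sym (pos-+ 1 (u ℕ.* v)) ⟩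
  + (1 ℕ.+ u ℕ.* v)  ≡⟨ cong +_ eq ⟩
  + (s ℕ.* t)        ≡⟨ pos-* s t ⟩
  + s * + t          ∎

subtract-one : ∀ u v → 1ℤ + u ≡ v → v - u ≡ 1ℤ
subtract-one u _ refl = identity u
  where
  identity : ∀ u → 1ℤ + u - u ≡ 1ℤ
  identity = solve-∀

complete-column : ∀ q x → Coprime q ∣ x ∣ → Σ ℤ λ y → Σ ℤ λ z → SL₂ (mat (+ q) y x z)
complete-column q (+ n) q⊥n with coprime-Bézout q⊥n
... | Bézout.+- a b eq =
  + b , + a ,
  trans (swap (+ q) (+ a) (+ b) (+ n))
        (subtract-one (+ b * + n) (+ a * + q) (identity-in-ℤ b n a q eq))
  where
  swap : ∀ q a b n → q * a - b * n ≡ a * q - b * n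
  swap = solve-∀
... | Bézout.-+ a b eq =
  - + b , - + a ,
  trans (negate (+ q) (+ a) (+ b) (+ n))
        (subtract-one (+ a * + q) (+ b * + n) (identity-in-ℤ a q b n eq))
  where
  negate : ∀ q a b n → q * (- a) - (- b) * n ≡ b * n - a * q
  negate = solve-∀
complete-column q -[1+ n ] q⊥n with complete-column q (+ suc n) q⊥n
... | y , z , det≡1 = - y , z , trans (negate (+ q) z y (+ suc n)) det≡1
  where
  negate : ∀ q z y n → q * z - (- y) * (- n) ≡ q * z - y * n
  negate = solve-∀

module _ {N q : ℕ} where

  H-gen : ∀ {M} → Γ₀ N M → A M ≡ + q → H N q M
  H-gen M∈Γ₀ AM≡q = gen-el (M∈Γ₀ , AM≡q)

  H⊆Γ₀ : ∀ {M} → H N q M → Γ₀ N M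
  H⊆Γ₀ = ⟨⟩-least (Γ₀-subgroup N) proj₁

  H-cancelˡ : ∀ {M X} → H N q M → H N q (M ⊗ X) → H N q X
  H-cancelˡ = ⟨⟩-cancelˡ (λ gen → proj₁ (proj₁ gen))

  H-cancelʳ : ∀ {M X} → H N q M → H N q (X ⊗ M) → H N q X
  H-cancelʳ = ⟨⟩-cancelʳ (λ gen → proj₁ (proj₁ gen))

module _ {N q : ℕ} (q⊥N : Coprime q N) where

  private
    column : Σ ℤ λ y → Σ ℤ λ z → SL₂ (mat (+ q) y (+ N) z)
    column = complete-column q (+ N) q⊥N

    M₀ : Mat
    M₀ = mat (+ q) (proj₁ column) (+ N) (proj₁ (proj₂ column))

    M₀∈Γ₀ : Γ₀ N M₀
    M₀∈Γ₀ = proj₂ (proj₂ column) , ℕ.∣-refl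

    M₀∈H : H N q M₀
    M₀∈H = H-gen M₀∈Γ₀ refl

  U∈H : ∀ k → H N q (U k)
  U∈H k = H-cancelˡ M₀∈H
    (H-gen (Γ₀-⊗ M₀ (U k) M₀∈Γ₀ (U∈Γ₀ N k)) (upper-left (+ q) (proj₁ column)))
    where
    upper-left : ∀ a b → a * 1ℤ + b * 0ℤ ≡ a
    upper-left = solve-∀

  W∈H : H N q (W N)
  W∈H = H-cancelʳ M₀∈H
    (H-gen (Γ₀-⊗ (W N) M₀ (W∈Γ₀ N) M₀∈Γ₀) (upper-left (+ q) (+ N)))
    where
    upper-left : ∀ a c → 1ℤ * a + 0ℤ * c ≡ a
    upper-left = solve-∀

  TW⊆H : ∀ {g} → ⟨ TW N ⟩ g → H N q g
  TW⊆H = ⟨⟩-least ⟨⟩-subgroup λ { (inj₁ refl) → U∈H 1ℤ ; (inj₂ refl) → W∈H }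

  double-coset-H : ∀ {g γ} → DoubleCoset N g γ → H N q γ → H N q g
  double-coset-H (x , y , x∈ , y∈ , refl) γ∈H = H-cancelˡ (TW⊆H x∈) (H-cancelʳ (TW⊆H y∈) γ∈H)

upper-left-adjust : ∀ n m s t r q b c d y z →
  r ≡ 1ℤ + n * (s * m) → q ≡ n * m * b + t * r →
  A (mat r b c d ⊗ (U (- (b + s * t)) ⊗ mat q y (n * m) z)) ≡ q
upper-left-adjust n m s t _ _ b c d y z refl refl = identity n m b s t
  where
  identity : ∀ n m b s t →
    let r = 1ℤ + n * (s * m) ; q = n * m * b + t * r in
    r * (1ℤ * q + (- (b + s * t)) * (n * m)) + b * (0ℤ * q + 1ℤ * (n * m)) ≡ q
  identity = solve-∀

x-y≡z⇒x≡y+z : ∀ x y z → x - y ≡ z → x ≡ y + z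
x-y≡z⇒x≡y+z x y _ refl = identity x y
  where
  identity : ∀ x y → x ≡ y + (x - y)
  identity = solve-∀

Γ₀-in-H : ∀ {N q : ℕ} (m : ℤ) {γ : Mat} →
  Coprime q N → Γ₀ N γ → DividesQuot m (A γ) N →
  Coprime q ∣ + N * m ∣ → (+ q) ≡ᶻ (+ N * m * B γ) [mod A γ ] → H N q γ
Γ₀-in-H {N} {q} m {mat r b c d} q⊥N γ∈Γ₀ (k , r-1≡Nk , m∣k) q⊥Nm r∣q-Nmb
  with Signed.∣ᵤ⇒∣ {m} {k} m∣k | Signed.∣ᵤ⇒∣ {r} {+ q - + N * m * b} r∣q-Nmb
     | complete-column q (+ N * m) q⊥Nm
... | Signed.divides s k≡sm | Signed.divides t q-Nmb≡tr | y , z , Y-det =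
  H-cancelʳ X∈H (H-gen (Γ₀-⊗ (mat r b c d) X γ∈Γ₀ (H⊆Γ₀ X∈H)) γX-upper-left)
  where
  Y : Mat
  Y = mat (+ q) y (+ N * m) z

  X : Mat
  X = U (- (b + s * t)) ⊗ Y

  Y∈Γ₀ : Γ₀ N Y
  Y∈Γ₀ = Y-det , Signed.∣⇒∣ᵤ {+ N} {+ N * m} (Signed.∣m⇒∣m*n {+ N} {+ N} m Signed.∣-refl)

  X∈H : H N q X
  X∈H = gen-mul (U∈H q⊥N (- (b + s * t))) (H-gen {M = Y} Y∈Γ₀ refl)

  γX-upper-left : A (mat r b c d ⊗ X) ≡ + q
  γX-upper-left = upper-left-adjust (+ N) m s t r (+ q) b c d y z
    (trans (x-y≡z⇒x≡y+z r 1ℤ (+ N * k) r-1≡Nk) (cong (λ v → 1ℤ + + N * v) k≡sm))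
    (x-y≡z⇒x≡y+z (+ q) (+ N * m * b) (t * r) q-Nmb≡tr)

lemma4p13 : (N : ℕ) → .{{_ : NonZero N}} → (h : ℕ) → (g : Fin h → Mat)
    → (∀ i → Γ₁ N (g i))
    → (∀ x → Γ₁ N x → ⟨ (λ y → Σ (Fin h) (λ i → y ≡ g i)) ⟩ x)
    → (γ : Fin h → Mat) → (∀ i → DoubleCoset N (g i) (γ i))
    → (m : Fin h → ℤ) → (∀ i → DividesQuot (m i) (A (γ i)) N)
    → (q : ℕ) → Coprime q N
    → (∀ i → Coprime q (∣ + N * m i ∣))
    → (∀ i → (+ q) ≡ᶻ ((+ N) * m i * B (γ i)) [mod (A (γ i)) ])
    → ∀ x → Γ₁ N x → H N q x
lemma4p13 N h g g∈Γ₁ g-generate γ γ∈TgT m m∣ q q⊥N q⊥Nm q≡Nmb x x∈Γ₁ =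
  ⟨⟩-least ⟨⟩-subgroup generator∈H (g-generate x x∈Γ₁)
  where
  γ∈H : ∀ i → H N q (γ i)
  γ∈H i = Γ₀-in-H (m i) q⊥N (double-coset-Γ₀ (Γ₁⊆Γ₀ {N} {g i} (g∈Γ₁ i)) (γ∈TgT i))
                  (m∣ i) (q⊥Nm i) (q≡Nmb i)

  generator∈H : ∀ {y} → Σ (Fin h) (λ i → y ≡ g i) → H N q y
  generator∈H (i , refl) = double-coset-H q⊥N (γ∈TgT i) (γ∈H i)
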